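{- For any $m\ge1$, any keyword $a\in\{0,1\}^{m+1}$ and any $n\ge1$, the graph $\mathcal{G}_n^{(a)}$ is bipartite.
   Context: Binary words are elements of $\{0,1\}^n$; $\neg$ flips every letter; $u_{[i,j]}=(u_i,\dots,u_j)$. For a keyword $a\in\{0,1\}^{m+1}$ and $i\in\{1,\dots,n\}$, the simple map $\varphi_i^{(a)}:\{0,1\}^n\to\{0,1\}^n$ negates the letters of $u$ in positions $i,\dots,i+m$ if $i+m\le n$ and $u_{[i,i+m]}\in\{a,\neg a\}$, and otherwise returns $u$ unchanged. The graph $\mathcal{G}_n^{(a)}$ has vertex set $\{0,1\}^n$, and $\{u,v\}$ is an edge iff $v=\varphi_i^{(a)}(u)\ne u$ for some $i\in\{1,\dots,n-m\}$. -}

module Defs where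

open import Data.Nat using (ℕ; zero; suc; _+_; _≤_; _≤?_)
open import Data.Bool using (Bool; true; false; not; _∧_; _∨_; if_then_else_)
open import Data.Vec using (Vec; []; _∷_; map; lookup; tabulate)
open import Data.Fin using (Fin; toℕ)
open import Data.Product using (Σ; ∃; _×_; _,_)
open import Relation.Binary.PropositionalEquality using (_≡_; _≢_)
open import Relation.Nullary.Decidable using (⌊_⌋)
open import Data.Vec.Properties using (≡-dec)
open import Data.Bool.Properties using () renaming (_≟_ to _≟B_)

Word : ℕ → Set
Word n = Vec Bool n

neg : ∀ {k} → Word k → Word k
neg = map not

-- Letter at 1-based position p (false if out of range; only used in range).
letter : ∀ {n} → Word n → ℕ → Bool
letter [] _ = false
letter (x ∷ u) zero = false
letter (x ∷ u) (suc zero) = x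
letter (x ∷ u) (suc (suc p)) = letter u (suc p)

factor : ∀ {n} (m : ℕ) → Word n → ℕ → Word (suc m)
factor m u i = tabulate λ (k : Fin (suc m)) → letter u (i + toℕ k)

inWindow : ℕ → ℕ → ℕ → Bool
inWindow m i p = ⌊ i ≤? p ⌋ ∧ ⌊ p ≤? i + m ⌋

φ : ∀ {m n} → Word (suc m) → ℕ → Word n → Word n
φ {m} {n} a i u =
  if ⌊ 1 ≤? i ⌋ ∧ ⌊ i + m ≤? n ⌋
       ∧ (⌊ ≡-dec _≟B_ (factor m u i) a ⌋ ∨ ⌊ ≡-dec _≟B_ (factor m u i) (neg a) ⌋)
  then tabulate (λ (q : Fin n) →
         let p = suc (toℕ q) in
         if inWindow m i p then not (letter u p) else letter u p)
  else u

Edge : ∀ {m n} → Word (suc m) → Word n → Word n → Set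
Edge {m} {n} a u v =
  Σ ℕ λ i → (1 ≤ i) × (i + m ≤ n) × (v ≡ φ a i u) × (v ≢ u)

Bipartite : (V : Set) → (V → V → Set) → Set
Bipartite V E = Σ (V → Bool) λ c → ∀ u v → E u v → c u ≢ c v

G-bipartite : (m n : ℕ) → Word (suc m) → Set
G-bipartite m n a = Bipartite (Word n) (Edge a)

{-# OPTIONS --safe #-}
-- Colour a word by the parity of its letters at the positions divisible by m + 1.
-- Any m + 1 consecutive positions contain exactly one such position, so every
-- simple map, which negates a whole window of length m + 1, flips the colour.
module Submission where

open import Defs
open import Algebra using (CommutativeRing)
open import Data.Bool using (Bool; true; false; not; _∧_; _xor_; if_then_else_)
open import Data.Bool.Properties
  using (xor-∧-commutativeRing; xor-assoc; xor-comm; xor-identityʳ; ∧-distribˡ-xor; ∧-zeroʳ; ∧-identityʳ; not-¬)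
open import Data.Empty using (⊥-elim)
open import Data.Fin using (Fin; toℕ; fromℕ<) renaming (zero to fzero; suc to fsuc)
open import Data.Fin.Properties using (toℕ-fromℕ<)
open import Data.Nat using (ℕ; zero; suc; _+_; _≤_; _<_; _≤?_; _%_; _≡ᵇ_; NonZero; s≤s; z≤n)
open import Data.Nat.DivMod using ([m+n]%n≡m%n; m<n⇒m%n≡m)
open import Data.Nat.Properties
open import Data.Product using (_,_)
open import Data.Sum using (_⊎_; inj₁; inj₂)
open import Data.Vec using (tabulate)
open import Relation.Nullary.Decidable using (⌊_⌋; isYes≗does; dec-true; dec-false)
open import Relation.Binary.PropositionalEquality
open import Algebra.Properties.CommutativeSemigroup
  (CommutativeRing.+-commutativeSemigroup xor-∧-commutativeRing) using (interchange)

open ≡-Reasoning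

xorRange : (ℕ → Bool) → ℕ → ℕ → Bool
xorRange f i zero    = false
xorRange f i (suc l) = f i xor xorRange f (suc i) l

xorRange-cong : ∀ {f g} i l → (∀ p → i ≤ p → p < i + l → f p ≡ g p) →
                xorRange f i l ≡ xorRange g i l
xorRange-cong i zero    f≗g = refl
xorRange-cong i (suc l) f≗g =
  cong₂ _xor_ (f≗g i ≤-refl (m<m+n i (s≤s z≤n)))
              (xorRange-cong (suc i) l λ p i<p p<1+i+l →
                 f≗g p (<⇒≤ i<p) (subst (p <_) (sym (+-suc i l)) p<1+i+l))

xorRange-false : ∀ i l → xorRange (λ _ → false) i l ≡ false
xorRange-false i zero    = refl
xorRange-false i (suc l) = xorRange-false (suc i) l

xorRange-vanishing : ∀ {f} i l → (∀ p → i ≤ p → p < i + l → f p ≡ false) →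
                     xorRange f i l ≡ false
xorRange-vanishing i l f≗false = trans (xorRange-cong i l f≗false) (xorRange-false i l)

xorRange-xor : ∀ f g i l →
               xorRange (λ p → f p xor g p) i l ≡ xorRange f i l xor xorRange g i l
xorRange-xor f g i zero    = refl
xorRange-xor f g i (suc l) rewrite xorRange-xor f g (suc i) l =
  interchange (f i) (g i) (xorRange f (suc i) l) (xorRange g (suc i) l)

xorRange-+ : ∀ f i k l → xorRange f i (k + l) ≡ xorRange f i k xor xorRange f (i + k) l
xorRange-+ f i zero    l rewrite +-identityʳ i = refl
xorRange-+ f i (suc k) l rewrite xorRange-+ f (suc i) k l | +-suc i k =
  sym (xor-assoc (f i) (xorRange f (suc i) k) (xorRange f (suc (i + k)) l))

xorRange-suc : ∀ f i l → xorRange f i (suc l) ≡ xorRange f i l xor f (i + l)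
xorRange-suc f i l = begin
  xorRange f i (suc l)                           ≡⟨ cong (xorRange f i) (+-comm 1 l) ⟩
  xorRange f i (l + 1)                           ≡⟨ xorRange-+ f i l 1 ⟩
  xorRange f i l xor (f (i + l) xor false)       ≡⟨ cong (xorRange f i l xor_) (xor-identityʳ _) ⟩
  xorRange f i l xor f (i + l)                   ∎

infix 4 _∣ᵇ_

_∣ᵇ_ : (d p : ℕ) .{{_ : NonZero d}} → Bool
d ∣ᵇ p = p % d ≡ᵇ 0

∣ᵇ-+-period : ∀ d .{{_ : NonZero d}} p → (d ∣ᵇ p + d) ≡ (d ∣ᵇ p)
∣ᵇ-+-period d p = cong (_≡ᵇ 0) ([m+n]%n≡m%n p d)

∣ᵇ-below : ∀ d .{{_ : NonZero d}} {p} → 0 < p → p < d → (d ∣ᵇ p) ≡ false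
∣ᵇ-below d {suc p} _ p<d = cong (_≡ᵇ 0) (m<n⇒m%n≡m p<d)

xorRange-∣ᵇ-block : ∀ d .{{_ : NonZero d}} i → xorRange (d ∣ᵇ_) i d ≡ true
xorRange-∣ᵇ-block (suc m) zero =
  cong (true xor_) (xorRange-vanishing 1 m λ p 0<p p<1+m → ∣ᵇ-below (suc m) 0<p p<1+m)
xorRange-∣ᵇ-block (suc m) (suc i) = begin
  xorRange (d ∣ᵇ_) (suc i) d                 ≡⟨ xorRange-suc (d ∣ᵇ_) (suc i) m ⟩
  xorRange (d ∣ᵇ_) (suc i) m xor (d ∣ᵇ suc i + m)
    ≡⟨ cong (xorRange (d ∣ᵇ_) (suc i) m xor_)
            (trans (cong (d ∣ᵇ_) (sym (+-suc i m))) (∣ᵇ-+-period d i)) ⟩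
  xorRange (d ∣ᵇ_) (suc i) m xor (d ∣ᵇ i)   ≡⟨ xor-comm _ (d ∣ᵇ i) ⟩
  xorRange (d ∣ᵇ_) i d                       ≡⟨ xorRange-∣ᵇ-block d i ⟩
  true                                       ∎
  where d = suc m

≤?-true : ∀ {x y} → x ≤ y → ⌊ x ≤? y ⌋ ≡ true
≤?-true {x} {y} x≤y = trans (isYes≗does (x ≤? y)) (dec-true (x ≤? y) x≤y)

≤?-false : ∀ {x y} → y < x → ⌊ x ≤? y ⌋ ≡ false
≤?-false {x} {y} y<x = trans (isYes≗does (x ≤? y)) (dec-false (x ≤? y) (<⇒≱ y<x))

inWindow-inside : ∀ {m i p} → i ≤ p → p ≤ i + m → inWindow m i p ≡ true
inWindow-inside i≤p p≤i+m = cong₂ _∧_ (≤?-true i≤p) (≤?-true p≤i+m)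

inWindow-before : ∀ {m i p} → p < i → inWindow m i p ≡ false
inWindow-before {m} {i} {p} p<i = cong (_∧ ⌊ p ≤? i + m ⌋) (≤?-false p<i)

inWindow-after : ∀ {m i p} → i + m < p → inWindow m i p ≡ false
inWindow-after {m} {i} {p} i+m<p =
  trans (cong (⌊ i ≤? p ⌋ ∧_) (≤?-false i+m<p)) (∧-zeroʳ _)

j+[k+1+m]≡1+j+k+m : ∀ j k m → j + (k + suc m) ≡ suc (j + k + m)
j+[k+1+m]≡1+j+k+m j k m =
  trans (cong (j +_) (+-suc k m)) (trans (+-suc j (k + m)) (cong suc (sym (+-assoc j k m))))

j+k+m<j+l⇒k+1+m≤l : ∀ j k m {l} → j + k + m < j + l → k + suc m ≤ l
j+k+m<j+l⇒k+1+m≤l j k m {l} lt =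
  +-cancelˡ-≤ j _ _ (subst (_≤ j + l) (sym (j+[k+1+m]≡1+j+k+m j k m)) lt)

xorRange-∧-inWindow : ∀ f m {i j l} → j ≤ i → i + m < j + l →
                      xorRange (λ p → f p ∧ inWindow m i p) j l ≡ xorRange f i (suc m)
xorRange-∧-inWindow f m {j = j} {l} j≤i i+m<j+l with m≤n⇒∃[o]m+o≡n j≤i
... | k , refl with m≤n⇒∃[o]m+o≡n (j+k+m<j+l⇒k+1+m≤l j k m i+m<j+l)
... | r , refl = begin
  xorRange F j (k + suc m + r)
    ≡⟨ xorRange-+ F j (k + suc m) r ⟩
  xorRange F j (k + suc m) xor xorRange F (j + (k + suc m)) r
    ≡⟨ cong (_xor xorRange F (j + (k + suc m)) r) (xorRange-+ F j k (suc m)) ⟩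
  (xorRange F j k xor xorRange F (j + k) (suc m)) xor xorRange F (j + (k + suc m)) r
    ≡⟨ cong₂ (λ x y → (x xor xorRange F (j + k) (suc m)) xor y) before after ⟩
  xorRange F (j + k) (suc m) xor false
    ≡⟨ xor-identityʳ _ ⟩
  xorRange F (j + k) (suc m)
    ≡⟨ xorRange-cong (j + k) (suc m) inside ⟩
  xorRange f (j + k) (suc m) ∎
  where
  F : ℕ → Bool
  F p = f p ∧ inWindow m (j + k) p
  before : xorRange F j k ≡ false
  before = xorRange-vanishing j k λ p _ p<j+k →
    trans (cong (f p ∧_) (inWindow-before p<j+k)) (∧-zeroʳ (f p))
  after : xorRange F (j + (k + suc m)) r ≡ false
  after = xorRange-vanishing (j + (k + suc m)) r λ p end≤p _ →
    trans (cong (f p ∧_) (inWindow-after (subst (_≤ p) (j+[k+1+m]≡1+j+k+m j k m) end≤p)))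
          (∧-zeroʳ (f p))
  inside : ∀ p → j + k ≤ p → p < j + k + suc m → F p ≡ f p
  inside p j+k≤p p<end =
    trans (cong (f p ∧_) (inWindow-inside j+k≤p (≤-pred (subst (p <_) (+-suc (j + k) m) p<end))))
          (∧-identityʳ (f p))

flipWindow : ∀ {n} → ℕ → ℕ → Word n → Word n
flipWindow {n} m i u = tabulate λ (q : Fin n) →
  let p = suc (toℕ q) in
  if inWindow m i p then not (letter u p) else letter u p

if-either : ∀ {A : Set} b {x y : A} → (if b then x else y) ≡ x ⊎ (if b then x else y) ≡ y
if-either true  = inj₁ refl
if-either false = inj₂ refl

φ-cases : ∀ {m n} (a : Word (suc m)) i (u : Word n) → φ a i u ≡ flipWindow m i u ⊎ φ a i u ≡ u
φ-cases a i u = if-either _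

letter-tabulate : ∀ {n} (h : Fin n → Bool) q → letter (tabulate h) (suc (toℕ q)) ≡ h q
letter-tabulate h fzero    = refl
letter-tabulate h (fsuc q) = letter-tabulate (λ q → h (fsuc q)) q

if-not-else : ∀ b x → (if b then not x else x) ≡ b xor x
if-not-else true  x = refl
if-not-else false x = refl

letter-flipWindow : ∀ m i {n p} (u : Word n) → 0 < p → p ≤ n →
                    letter (flipWindow m i u) p ≡ inWindow m i p xor letter u p
letter-flipWindow m i {p = suc p} u _ p<n =
  subst (λ k → letter (flipWindow m i u) (suc k) ≡ inWindow m i (suc k) xor letter u (suc k))
        (toℕ-fromℕ< p<n)
        (trans (letter-tabulate _ q)
               (if-not-else (inWindow m i (suc (toℕ q))) (letter u (suc (toℕ q)))))
  where q = fromℕ< p<n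

colour : ∀ {n} → ℕ → Word n → Bool
colour {n} m u = xorRange (λ p → (suc m ∣ᵇ p) ∧ letter u p) 1 n

colour-flipWindow : ∀ {m n i} → 1 ≤ i → i + m ≤ n → (u : Word n) →
                    colour m (flipWindow m i u) ≡ not (colour m u)
colour-flipWindow {m} {n} {i} 1≤i i+m≤n u = begin
  colour m (flipWindow m i u)
    ≡⟨ xorRange-cong 1 n (λ p 0<p p<1+n →
         trans (cong ((suc m ∣ᵇ p) ∧_) (letter-flipWindow m i u 0<p (≤-pred p<1+n)))
               (∧-distribˡ-xor (suc m ∣ᵇ p) _ _)) ⟩
  xorRange (λ p → ((suc m ∣ᵇ p) ∧ inWindow m i p) xor ((suc m ∣ᵇ p) ∧ letter u p)) 1 n
    ≡⟨ xorRange-xor _ _ 1 n ⟩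
  xorRange (λ p → (suc m ∣ᵇ p) ∧ inWindow m i p) 1 n xor colour m u
    ≡⟨ cong (_xor colour m u) (xorRange-∧-inWindow (suc m ∣ᵇ_) m 1≤i (s≤s i+m≤n)) ⟩
  xorRange (suc m ∣ᵇ_) i (suc m) xor colour m u
    ≡⟨ cong (_xor colour m u) (xorRange-∣ᵇ-block (suc m) i) ⟩
  not (colour m u) ∎

colour-edge : ∀ {m n} (a : Word (suc m)) (u v : Word n) → Edge a u v → colour m u ≢ colour m v
colour-edge a u _ (i , 1≤i , i+m≤n , refl , φ≢u) with φ-cases a i u
... | inj₂ φ≡u    = ⊥-elim (φ≢u φ≡u)
... | inj₁ φ≡flip = λ cu≡cv →
  not-¬ refl (trans cu≡cv (trans (cong (colour _) φ≡flip) (colour-flipWindow 1≤i i+m≤n u)))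

-- The colouring also works for m = 0 and n = 0.
proposition3p8 : (m : ℕ) → 1 ≤ m → (a : Word (suc m)) → (n : ℕ) → 1 ≤ n →
    Bipartite (Word n) (Edge a)
proposition3p8 m _ a n _ = colour m , colour-edge a
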